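{- Let $p$ be a prime. Let $n,m,N$ be positive integers with $n\equiv m\pmod{\varphi(p^N)}$ and $m,n\ge N$, where $\varphi$ is Euler's totient function. Then for every integer $j\ge0$, \[ j!\left\{{n\atop j}\right\}\equiv j!\left\{{m\atop j}\right\}\pmod{p^N}. \]
   Context: The Stirling numbers of the second kind $\left\{{n\atop m}\right\}$ are given by $\left\{{0\atop 0}\right\}=1$, $\left\{{n\atop 0}\right\}=\left\{{0\atop m}\right\}=0$ for $n,m\ne0$, and $\left\{{n\atop m}\right\}=\left\{{n-1\atop m-1}\right\}+m\left\{{n-1\atop m}\right\}$. -}

module Defs where

open import Data.Nat.Base using (ℕ; zero; suc; _+_; _*_; ∣_-_∣)
open import Data.Nat.Divisibility using (_∣_)
open import Data.Nat.Coprimality using (coprime?)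
open import Relation.Nullary.Decidable using (does)
open import Data.Bool.Base using (if_then_else_)

S₂ : ℕ → ℕ → ℕ
S₂ zero    zero    = 1
S₂ zero    (suc m) = 0
S₂ (suc n) zero    = 0
S₂ (suc n) (suc m) = S₂ n m + suc m * S₂ n (suc m)

countCoprime : ℕ → ℕ → ℕ
countCoprime n zero    = 0
countCoprime n (suc k) =
  (if does (coprime? (suc k) n) then 1 else 0) + countCoprime n k

φ : ℕ → ℕ
φ n = countCoprime n n

infix 4 _≡_[mod_]
_≡_[mod_] : ℕ → ℕ → ℕ → Set
a ≡ b [mod k ] = k ∣ ∣ a - b ∣

-- Let T(n, j) = j! S(n, j), the number of surjections from an n-set onto a j-set.
-- Sorting the maps from an n-set to an x-set by their image gives
-- x^n = Σ_j C(x, j) T(n, j); as C(j, j) = 1 this system is triangular, so by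
-- induction on j the T(n, j) are determined modulo any d by the values of x^n
-- modulo d. It therefore suffices that x^n ≡ x^m (mod p^N) for every x. If
-- p ∣ x both sides vanish because n, m ≥ N. Otherwise x^φ(p^N) ≡ 1 (mod p^N):
-- Fermat's little theorem is lifted from p to p^N, since x ≡ 1 (mod D) with
-- p ∣ D gives x^p ≡ 1 (mod Dp). Finally φ(p^N) = p^(N-1)(p-1) divides n - m.
module Submission where

open import Defs
open import Data.Nat.Base
open import Data.Nat.Properties
open import Data.Nat.DivMod
open import Data.Nat.Divisibility
open import Data.Nat.Induction using (<-rec)
open import Data.Nat.Primality
  using (Prime; euclidsLemma; prime⇒irreducible; prime⇒nonTrivial; prime⇒nonZero)
open import Data.Nat.Coprimality using (Coprime; coprime?; coprime-divisor)
open import Data.Nat.Combinatorics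
  using (_C_; nCn≡1; nC1≡n; k>n⇒nCk≡0; nCk+nC[k+1]≡[n+1]C[k+1])
open import Data.Nat.Solver using (module +-*-Solver)
open import Data.Fin.Base using (Fin; zero; suc; toℕ)
open import Data.Fin.Properties using (toℕ<n; toℕ-inject₁; toℕ-fromℕ)
open import Data.Bool.Base using (if_then_else_)
open import Data.Product using (_,_)
open import Data.Sum using (inj₁; inj₂)
open import Algebra.Properties.Monoid.Sum +-0-monoid
  using (sum; sum-syntax; sum⁺-syntax; sum-cong-≗; sum-init-last; sum-replicate; sum-replicate-zero)
open import Algebra.Properties.CommutativeMonoid.Sum +-0-commutativeMonoid using (∑-distrib-+)
open import Algebra.Properties.Semiring.Sum +-*-semiring using (*-distribˡ-sum)
import Algebra.Properties.CommutativeSemiring.Binomial +-*-commutativeSemiring as Binomial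
import Algebra.Definitions.RawMonoid +-0-rawMonoid as RawMonoid
import Algebra.Definitions.RawSemiring +-*-rawSemiring as RawSemiring
open import Relation.Nullary using (¬_; yes; no; contradiction)
open import Relation.Nullary.Decidable using (dec-true; dec-false)
open import Relation.Binary.PropositionalEquality
open ≡-Reasoning
open +-*-Solver

-- Congruences are handled as equalities of remainders, a % d ≡ b % d, and
-- converted to and from the divisibility form a ≡ b [mod d] where needed.

private
  ∣∸⇒%≡% : ∀ {a b d} .{{_ : NonZero d}} → b ≤ a → d ∣ a ∸ b → a % d ≡ b % d
  ∣∸⇒%≡% {a} {b} {d} b≤a d∣a∸b = begin
    a % d             ≡⟨ cong (_% d) (m+[n∸m]≡n b≤a) ⟨
    (b + (a ∸ b)) % d ≡⟨ %-remove-+ʳ b d∣a∸b ⟩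
    b % d             ∎

  %≡%⇒∣∸ : ∀ {a b d} .{{_ : NonZero d}} → b ≤ a → a % d ≡ b % d → d ∣ a ∸ b
  %≡%⇒∣∸ {a} {b} {d} b≤a a%d≡b%d = divides (a / d ∸ b / d) (begin
    a ∸ b
      ≡⟨ cong₂ _∸_ (m≡m%n+[m/n]*n a d) (m≡m%n+[m/n]*n b d) ⟩
    (a % d + a / d * d) ∸ (b % d + b / d * d)
      ≡⟨ cong (λ r → (r + a / d * d) ∸ (b % d + b / d * d)) a%d≡b%d ⟩
    (b % d + a / d * d) ∸ (b % d + b / d * d)
      ≡⟨ [m+n]∸[m+o]≡n∸o (b % d) _ _ ⟩
    a / d * d ∸ b / d * d
      ≡⟨ *-distribʳ-∸ d (a / d) (b / d) ⟨
    (a / d ∸ b / d) * d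
      ∎)

≡[mod]⇒%≡% : ∀ {a b d} .{{_ : NonZero d}} → a ≡ b [mod d ] → a % d ≡ b % d
≡[mod]⇒%≡% {a} {b} d∣ with ≤-total b a
... | inj₁ b≤a = ∣∸⇒%≡% b≤a (subst (_ ∣_) (m≤n⇒∣n-m∣≡n∸m b≤a) d∣)
... | inj₂ a≤b = sym (∣∸⇒%≡% a≤b (subst (_ ∣_) (m≤n⇒∣m-n∣≡n∸m a≤b) d∣))

%≡%⇒≡[mod] : ∀ {a b d} .{{_ : NonZero d}} → a % d ≡ b % d → a ≡ b [mod d ]
%≡%⇒≡[mod] {a} {b} a%d≡b%d with ≤-total b a
... | inj₁ b≤a = subst (_ ∣_) (sym (m≤n⇒∣n-m∣≡n∸m b≤a)) (%≡%⇒∣∸ b≤a a%d≡b%d)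
... | inj₂ a≤b = subst (_ ∣_) (sym (m≤n⇒∣m-n∣≡n∸m a≤b)) (%≡%⇒∣∸ a≤b (sym a%d≡b%d))

module _ {d : ℕ} .{{_ : NonZero d}} where

  %-cong-+ : ∀ {a b x y} → a % d ≡ b % d → x % d ≡ y % d → (a + x) % d ≡ (b + y) % d
  %-cong-+ {a} {b} {x} {y} a≡b x≡y = begin
    (a + x) % d         ≡⟨ %-distribˡ-+ a x d ⟩
    (a % d + x % d) % d ≡⟨ cong₂ (λ u v → (u + v) % d) a≡b x≡y ⟩
    (b % d + y % d) % d ≡⟨ %-distribˡ-+ b y d ⟨
    (b + y) % d         ∎

  %-cong-* : ∀ {a b x y} → a % d ≡ b % d → x % d ≡ y % d → (a * x) % d ≡ (b * y) % d
  %-cong-* {a} {b} {x} {y} a≡b x≡y = begin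
    (a * x) % d           ≡⟨ %-distribˡ-* a x d ⟩
    (a % d * (x % d)) % d ≡⟨ cong₂ (λ u v → (u * v) % d) a≡b x≡y ⟩
    (b % d * (y % d)) % d ≡⟨ %-distribˡ-* b y d ⟨
    (b * y) % d           ∎

  %-cong-^ : ∀ {a b} k → a % d ≡ b % d → a ^ k % d ≡ b ^ k % d
  %-cong-^ zero    a≡b = refl
  %-cong-^ (suc k) a≡b = %-cong-* a≡b (%-cong-^ k a≡b)

  %-cong-sum : ∀ {n} (f g : Fin n → ℕ) → (∀ i → f i % d ≡ g i % d) → sum f % d ≡ sum g % d
  %-cong-sum {zero}  f g f≡g = refl
  %-cong-sum {suc n} f g f≡g =
    %-cong-+ (f≡g zero) (%-cong-sum (λ i → f (suc i)) (λ i → g (suc i)) (λ i → f≡g (suc i)))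

  +-cancelˡ-% : ∀ c {x y} → (c + x) % d ≡ (c + y) % d → x % d ≡ y % d
  +-cancelˡ-% c {x} {y} eq =
    ≡[mod]⇒%≡% (subst (d ∣_) (∣m+n-m+o∣≡∣n-o∣ c x y) (%≡%⇒≡[mod] eq))

  +-cancel-% : ∀ {a b x y} → a % d ≡ b % d → (a + x) % d ≡ (b + y) % d → x % d ≡ y % d
  +-cancel-% {a} a≡b eq = +-cancelˡ-% a (trans eq (%-cong-+ (sym a≡b) refl))

*-cancelˡ-% : ∀ {p} .{{_ : NonZero p}} → Prime p → ∀ c {x y} → ¬ p ∣ c →
              (c * x) % p ≡ (c * y) % p → x % p ≡ y % p
*-cancelˡ-% {p} pr c {x} {y} p∤c eq
  with euclidsLemma c ∣ x - y ∣ pr (subst (p ∣_) (sym (*-distribˡ-∣-∣ c x y)) (%≡%⇒≡[mod] eq))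
... | inj₁ p∣c   = contradiction p∣c p∤c
... | inj₂ p∣x-y = ≡[mod]⇒%≡% p∣x-y

∣-sum : ∀ {d n} (f : Fin n → ℕ) → (∀ i → d ∣ f i) → d ∣ sum f
∣-sum {n = zero}  f d∣f = _ ∣0
∣-sum {n = suc n} f d∣f = ∣m∣n⇒∣m+n (d∣f zero) (∣-sum (λ i → f (suc i)) (λ i → d∣f (suc i)))

∑-init-last : ∀ n (f : ℕ → ℕ) → ∑[ i < suc n ] f (toℕ i) ≡ ∑[ i < n ] f (toℕ i) + f n
∑-init-last n f = trans (sum-init-last (λ i → f (toℕ i)))
  (cong₂ _+_ (sum-cong-≗ {n} (λ i → cong f (toℕ-inject₁ i))) (cong f (toℕ-fromℕ n)))

×≡* : ∀ n x → n RawMonoid.× x ≡ n * x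
×≡* zero    x = refl
×≡* (suc n) x = cong (x +_) (×≡* n x)

∑1≡n : ∀ n → ∑[ i < n ] 1 ≡ n
∑1≡n n = trans (sum-replicate n) (trans (×≡* n 1) (*-identityʳ n))

pascal : ∀ n k → suc n C suc k ≡ n C k + n C suc k
pascal n k = sym (nCk+nC[k+1]≡[n+1]C[k+1] n k)

absorption : ∀ n k → suc k * (suc n C suc k) ≡ suc n * (n C k)
absorption n       zero    = trans (*-identityˡ _) (trans (nC1≡n (suc n)) (sym (*-identityʳ _)))
absorption zero    (suc k) = *-zeroʳ (2 + k)
absorption (suc n) (suc k) = begin
  suc (suc k) * (suc (suc n) C suc (suc k))
    ≡⟨ cong (suc (suc k) *_) (pascal (suc n) (suc k)) ⟩
  suc (suc k) * (suc n C suc k + suc n C suc (suc k))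
    ≡⟨ solve 3 (λ k a b → (con 1 :+ k) :* (a :+ b) := a :+ (k :* a :+ (con 1 :+ k) :* b))
         refl (suc k) (suc n C suc k) (suc n C suc (suc k)) ⟩
  suc n C suc k + (suc k * (suc n C suc k) + suc (suc k) * (suc n C suc (suc k)))
    ≡⟨ cong (suc n C suc k +_) (cong₂ _+_ (absorption n k) (absorption n (suc k))) ⟩
  suc n C suc k + (suc n * (n C k) + suc n * (n C suc k))
    ≡⟨ cong (suc n C suc k +_)
         (trans (cong (suc n *_) (pascal n k)) (*-distribˡ-+ (suc n) (n C k) (n C suc k))) ⟨
  suc n C suc k + suc n * (suc n C suc k)
    ∎

n*nCk≡[1+k]*nC[1+k]+k*nCk : ∀ n k → n * (n C k) ≡ suc k * (n C suc k) + k * (n C k)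
n*nCk≡[1+k]*nC[1+k]+k*nCk n k = +-cancelˡ-≡ (n C k) _ _ (begin
  suc n * (n C k)
    ≡⟨ absorption n k ⟨
  suc k * (suc n C suc k)
    ≡⟨ cong (suc k *_) (pascal n k) ⟩
  suc k * (n C k + n C suc k)
    ≡⟨ solve 3 (λ k a b → (con 1 :+ k) :* (a :+ b) := a :+ ((con 1 :+ k) :* b :+ k :* a))
         refl k (n C k) (n C suc k) ⟩
  n C k + (suc k * (n C suc k) + k * (n C k))
    ∎)

p∣pC[1+k] : ∀ {p} → Prime p → ∀ k → suc k < p → p ∣ p C suc k
p∣pC[1+k] {suc p′} pr k k<p
  with euclidsLemma (suc k) (suc p′ C suc k) pr
         (divides (p′ C k) (trans (absorption p′ k) (*-comm (suc p′) (p′ C k))))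
... | inj₁ p∣1+k = contradiction p∣1+k (>⇒∤ k<p)
... | inj₂ p∣C   = p∣C

^≡^ : ∀ x n → x RawSemiring.^ n ≡ x ^ n
^≡^ x zero    = refl
^≡^ x (suc n) = cong (x *_) (^≡^ x n)

binomial-theorem : ∀ n x y → (x + y) ^ n ≡ ∑[ k ≤ n ] ((n C toℕ k) * (x ^ toℕ k * y ^ (n ∸ toℕ k)))
binomial-theorem n x y = begin
  (x + y) ^ n                      ≡⟨ ^≡^ (x + y) n ⟨
  (x + y) RawSemiring.^ n          ≡⟨ Binomial.theorem n x y ⟩
  Binomial.binomialExpansion x y n ≡⟨ sum-cong-≗ {suc n} (λ k → trans (×≡* (n C toℕ k) _)
                                      (cong₂ (λ u v → (n C toℕ k) * (u * v)) (^≡^ x (toℕ k)) (^≡^ y (n ∸ toℕ k)))) ⟩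
  ∑[ k ≤ n ] ((n C toℕ k) * (x ^ toℕ k * y ^ (n ∸ toℕ k))) ∎

freshman : ∀ {p} .{{_ : NonZero p}} → Prime p → ∀ a → suc a ^ p % p ≡ suc (a ^ p) % p
freshman {p@(suc p′)} pr a = begin
  suc a ^ p % p
    ≡⟨ cong (_% p) (binomial-theorem p 1 a) ⟩
  (t 0 + ∑[ k < p ] t (suc (toℕ k))) % p
    ≡⟨ cong (λ s → (t 0 + s) % p) (∑-init-last p′ (λ k → t (suc k))) ⟩
  (t 0 + (middle + t p)) % p
    ≡⟨ cong₂ (λ u v → (u + (middle + v)) % p) t0≡a^p tp≡1 ⟩
  (a ^ p + (middle + 1)) % p
    ≡⟨ cong (_% p) (solve 2 (λ x m → x :+ (m :+ con 1) := m :+ (con 1 :+ x)) refl (a ^ p) middle) ⟩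
  (middle + suc (a ^ p)) % p
    ≡⟨ %-remove-+ˡ (suc (a ^ p)) p∣middle ⟩
  suc (a ^ p) % p
    ∎
  where
  t : ℕ → ℕ
  t k = (p C k) * (1 ^ k * a ^ (p ∸ k))
  middle = ∑[ k < p′ ] t (suc (toℕ k))
  t0≡a^p : t 0 ≡ a ^ p
  t0≡a^p = trans (*-identityˡ _) (*-identityˡ _)
  tp≡1 : t p ≡ 1
  tp≡1 rewrite nCn≡1 p | ^-zeroˡ p | n∸n≡0 p′ = refl
  p∣middle : p ∣ middle
  p∣middle = ∣-sum _ (λ k → ∣m⇒∣m*n _ (p∣pC[1+k] pr (toℕ k) (s<s (toℕ<n k))))

fermat : ∀ {p} .{{_ : NonZero p}} → Prime p → ∀ a → a ^ p % p ≡ a % p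
fermat {suc p′}    pr zero    = refl
fermat {p@(suc _)} pr (suc a) =
  trans (freshman pr a) (%-cong-+ {a = 1} {b = 1} {x = a ^ p} {y = a} refl (fermat pr a))

fermat-unit : ∀ {p} .{{_ : NonZero p}} → Prime p → ∀ {a} → ¬ p ∣ a → a ^ (p ∸ 1) % p ≡ 1 % p
fermat-unit {suc p′} pr {a} p∤a = *-cancelˡ-% pr a p∤a
  (trans (fermat pr a) (cong (_% suc p′) (sym (*-identityʳ a))))

geometric-series : ∀ y n → suc y ^ n ≡ 1 + y * ∑[ i < n ] (suc y ^ toℕ i)
geometric-series y zero    = cong suc (sym (*-zeroʳ y))
geometric-series y (suc n) = begin
  suc y * suc y ^ n
    ≡⟨ cong (suc y *_) (geometric-series y n) ⟩
  suc y * (1 + y * G)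
    ≡⟨ solve 2 (λ y g → (con 1 :+ y) :* (con 1 :+ y :* g) := con 1 :+ y :* (con 1 :+ (con 1 :+ y) :* g))
         refl y G ⟩
  1 + y * (1 + suc y * G)
    ≡⟨ cong (λ s → 1 + y * (1 + s)) (*-distribˡ-sum {n} (suc y) (λ i → suc y ^ toℕ i)) ⟩
  1 + y * (1 + ∑[ i < n ] (suc y ^ suc (toℕ i)))
    ∎
  where G = ∑[ i < n ] (suc y ^ toℕ i)

-- (1 + y)^p = 1 + y Σ_{i<p} (1 + y)^i, and the sum is ≡ p ≡ 0 modulo p.
≡1-lift : ∀ {p D x} .{{_ : NonZero p}} → p ∣ D → x ≡ 1 [mod D ] → x ^ p ≡ 1 [mod D * p ]
≡1-lift {p} {D} {zero}  p∣D D∣1 with refl ← ∣1⇒≡1 D∣1 with refl ← ∣1⇒≡1 p∣D = 1∣ _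
≡1-lift {p} {D} {suc y} p∣D D∣∣y-0∣ = subst (D * p ∣_) (sym ∣[1+y]^p-1∣≡y*G) (*-pres-∣ D∣y p∣G)
  where
  D∣y : D ∣ y
  D∣y = subst (D ∣_) (∣-∣-identityʳ y) D∣∣y-0∣
  G = ∑[ i < p ] (suc y ^ toℕ i)
  1+y≡1 : suc y % p ≡ 1 % p
  1+y≡1 = %-remove-+ʳ 1 (∣-trans p∣D D∣y)
  p∣G : p ∣ G
  p∣G = m%n≡0⇒n∣m G p (begin
    G % p              ≡⟨ %-cong-sum {n = p} (λ i → suc y ^ toℕ i) (λ _ → 1)
                            (λ i → trans (%-cong-^ (toℕ i) 1+y≡1) (cong (_% p) (^-zeroˡ (toℕ i)))) ⟩
    (∑[ i < p ] 1) % p ≡⟨ cong (_% p) (∑1≡n p) ⟩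
    p % p              ≡⟨ n%n≡0 p ⟩
    0                  ∎)
  ∣[1+y]^p-1∣≡y*G : ∣ suc y ^ p - 1 ∣ ≡ y * G
  ∣[1+y]^p-1∣≡y*G = trans (cong (∣_- 1 ∣) (geometric-series y p)) (∣-∣-identityʳ (y * G))

euler-prime^ : ∀ {p} → Prime p → ∀ {a} → ¬ p ∣ a → ∀ N → a ^ (p ^ N * (p ∸ 1)) ≡ 1 [mod p ^ suc N ]
euler-prime^ {p@(suc p′)} pr {a} p∤a zero = subst₂ (λ e d → a ^ e ≡ 1 [mod d ])
  (sym (*-identityˡ p′)) (sym (*-identityʳ p)) (%≡%⇒≡[mod] {a ^ p′} {1} (fermat-unit pr p∤a))
euler-prime^ {p@(suc p′)} pr {a} p∤a (suc N) = subst₂ (λ x d → x ≡ 1 [mod d ])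
  exponent (*-comm (p ^ suc N) p)
  (≡1-lift {p} {p ^ suc N} {a ^ (p ^ N * p′)} (m∣m*n (p ^ N)) (euler-prime^ pr p∤a N))
  where
  exponent : (a ^ (p ^ N * p′)) ^ p ≡ a ^ (p ^ suc N * p′)
  exponent = trans (^-*-assoc a (p ^ N * p′) p)
    (cong (a ^_) (solve 3 (λ q r p → q :* r :* p := p :* q :* r) refl (p ^ N) p′ p))

¬∣⇒coprime-^ : ∀ {p x} → Prime p → ¬ p ∣ x → ∀ k → Coprime x (p ^ k)
¬∣⇒coprime-^ pr p∤x zero    (_ , i∣1) = ∣1⇒≡1 i∣1
¬∣⇒coprime-^ {p} {x} pr p∤x (suc k) {i} (i∣x , i∣p^[1+k]) =
  ¬∣⇒coprime-^ pr p∤x k (i∣x , coprime-divisor i⊥p i∣p^[1+k])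
  where
  i⊥p : Coprime i p
  i⊥p {e} (e∣i , e∣p) with prime⇒irreducible pr e∣p
  ... | inj₁ e≡1  = e≡1
  ... | inj₂ refl = contradiction (∣-trans e∣i i∣x) p∤x

∣⇒¬coprime-^ : ∀ {p x} → Prime p → p ∣ x → ∀ k → ¬ Coprime x (p ^ suc k)
∣⇒¬coprime-^ {p} pr p∣x k x⊥p^[1+k] =
  nonTrivial⇒≢1 {{prime⇒nonTrivial pr}} (x⊥p^[1+k] (p∣x , m∣m*n (p ^ k)))

φ[p^[1+N]] : ∀ {p} → Prime p → ∀ N → φ (p ^ suc N) ≡ p ^ N * (p ∸ 1)
φ[p^[1+N]] {p@(suc p′)} pr N =
  trans (cong (countCoprime M) (*-comm p (p ^ N))) (count (p ^ N) 0 z≤n)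
  where
  M = p ^ suc N
  count : ∀ q r → r ≤ p′ → countCoprime M (r + q * p) ≡ r + q * p′
  count zero    zero    _    = refl
  count (suc q) zero    _    = cong₂ _+_
    (cong (if_then 1 else 0) (dec-false (coprime? _ M) (∣⇒¬coprime-^ pr (n∣m*n (suc q)) N)))
    (count q p′ ≤-refl)
  count q       (suc r) r<p′ = cong₂ _+_
    (cong (if_then 1 else 0) (dec-true (coprime? _ M) (¬∣⇒coprime-^ pr p∤ (suc N))))
    (count q r (<⇒≤ r<p′))
    where
    p∤ : ¬ p ∣ suc r + q * p
    p∤ p∣ = >⇒∤ (s≤s r<p′) (∣m+n∣m⇒∣n (subst (p ∣_) (+-comm (suc r) (q * p)) p∣) (n∣m*n q))

^-monoˡ-∣ : ∀ {d x} k → d ∣ x → d ^ k ∣ x ^ k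
^-monoˡ-∣ zero    d∣x = ∣-refl
^-monoˡ-∣ (suc k) d∣x = *-pres-∣ d∣x (^-monoˡ-∣ k d∣x)

^-monoʳ-∣ : ∀ x {k n} → k ≤ n → x ^ k ∣ x ^ n
^-monoʳ-∣ x {k} {n} k≤n = divides (x ^ (n ∸ k)) (begin
  x ^ n               ≡⟨ cong (x ^_) (m+[n∸m]≡n k≤n) ⟨
  x ^ (k + (n ∸ k))   ≡⟨ ^-distribˡ-+-* x k (n ∸ k) ⟩
  x ^ k * x ^ (n ∸ k) ≡⟨ *-comm (x ^ k) _ ⟩
  x ^ (n ∸ k) * x ^ k ∎)

private
  ^-%-periodic-≤ : ∀ {d e x} .{{_ : NonZero d}} → x ^ e ≡ 1 [mod d ] →
                   ∀ {n m} → m ≤ n → n ≡ m [mod e ] → x ^ n % d ≡ x ^ m % d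
  ^-%-periodic-≤ {d} {e} {x} x^e≡1 {n} {m} m≤n e∣∣n-m∣
    with divides k n∸m≡ke ← subst (e ∣_) (m≤n⇒∣n-m∣≡n∸m m≤n) e∣∣n-m∣ = begin
    x ^ n % d               ≡⟨ cong (λ t → x ^ t % d) (trans (sym (m+[n∸m]≡n m≤n)) (cong (m +_) n∸m≡ke)) ⟩
    x ^ (m + k * e) % d     ≡⟨ cong (_% d) (^-distribˡ-+-* x m (k * e)) ⟩
    x ^ m * x ^ (k * e) % d ≡⟨ cong (λ t → x ^ m * t % d) (trans (cong (x ^_) (*-comm k e)) (sym (^-*-assoc x e k))) ⟩
    x ^ m * (x ^ e) ^ k % d ≡⟨ %-cong-* {a = x ^ m} refl (%-cong-^ k (≡[mod]⇒%≡% x^e≡1)) ⟩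
    x ^ m * 1 ^ k % d       ≡⟨ cong (λ t → x ^ m * t % d) (^-zeroˡ k) ⟩
    x ^ m * 1 % d           ≡⟨ cong (_% d) (*-identityʳ (x ^ m)) ⟩
    x ^ m % d               ∎

^-%-periodic : ∀ {d e x} .{{_ : NonZero d}} → x ^ e ≡ 1 [mod d ] →
               ∀ {n m} → n ≡ m [mod e ] → x ^ n % d ≡ x ^ m % d
^-%-periodic x^e≡1 {n} {m} n≡m with ≤-total m n
... | inj₁ m≤n = ^-%-periodic-≤ x^e≡1 m≤n n≡m
... | inj₂ n≤m = sym (^-%-periodic-≤ x^e≡1 n≤m (subst (_ ∣_) (∣-∣-comm n m) n≡m))

^-%-cong-prime^ : ∀ {p} → Prime p → ∀ {N} .{{_ : NonZero (p ^ N)}} → N > 0 →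
                  ∀ {n m} → n ≡ m [mod φ (p ^ N) ] → N ≤ n → N ≤ m →
                  ∀ x → x ^ n % p ^ N ≡ x ^ m % p ^ N
^-%-cong-prime^ {p} pr {suc N} _ {n} {m} n≡m N≤n N≤m x with p ∣? x
... | yes p∣x = trans (vanishes N≤n) (sym (vanishes N≤m))
  where
  vanishes : ∀ {k} → suc N ≤ k → x ^ k % p ^ suc N ≡ 0
  vanishes N≤k = n∣m⇒m%n≡0 _ _ (∣-trans (^-monoˡ-∣ (suc N) p∣x) (^-monoʳ-∣ x N≤k))
... | no p∤x =
  ^-%-periodic (euler-prime^ pr p∤x N) {n} {m} (subst (n ≡ m [mod_]) (φ[p^[1+N]] pr N) n≡m)

surjections : ℕ → ℕ → ℕ
surjections n j = j ! * S₂ n j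

surjections-suc : ∀ n j → surjections (suc n) (suc j) ≡ suc j * (surjections n j + surjections n (suc j))
surjections-suc n j = solve 4 (λ a f s t → (a :* f) :* (s :+ a :* t) := a :* (f :* s :+ (a :* f) :* t))
  refl (suc j) (j !) (S₂ n j) (S₂ n (suc j))

-- The sum may run over any range j < B that contains all j ≤ x, since x C j vanishes for j > x.
^≡∑C*surjections : ∀ {x B} → x < B → ∀ n → x ^ n ≡ ∑[ j < B ] ((x C toℕ j) * surjections n (toℕ j))
^≡∑C*surjections {x} {suc B} x<B zero = cong suc (sym (trans
  (sum-cong-≗ {B} (λ j → trans (cong ((x C suc (toℕ j)) *_) (*-zeroʳ (suc (toℕ j) !)))
                                (*-zeroʳ (x C suc (toℕ j)))))
  (sum-replicate-zero B)))
^≡∑C*surjections {x} {suc B} x<B (suc n) = begin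
  x * x ^ n
    ≡⟨ cong (x *_) (^≡∑C*surjections x<B n) ⟩
  x * ∑[ j < suc B ] ((x C toℕ j) * S n (toℕ j))
    ≡⟨ *-distribˡ-sum {suc B} x (λ j → (x C toℕ j) * S n (toℕ j)) ⟩
  ∑[ j < suc B ] (x * ((x C toℕ j) * S n (toℕ j)))
    ≡⟨ sum-cong-≗ {suc B} (λ j → split (toℕ j)) ⟩
  ∑[ j < suc B ] (g (toℕ j) + h (toℕ j))
    ≡⟨ ∑-distrib-+ {suc B} (λ j → g (toℕ j)) (λ j → h (toℕ j)) ⟩
  ∑[ j < suc B ] g (toℕ j) + ∑h
    ≡⟨ cong (_+ ∑h) (∑-init-last B g) ⟩
  ∑g + g B + ∑h
    ≡⟨ cong (λ z → ∑g + z + ∑h) g[B]≡0 ⟩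
  ∑g + 0 + ∑h
    ≡⟨ cong (_+ ∑h) (+-identityʳ ∑g) ⟩
  ∑g + ∑h
    ≡⟨ ∑-distrib-+ {B} (λ j → g (toℕ j)) (λ j → h (suc (toℕ j))) ⟨
  ∑[ j < B ] (g (toℕ j) + h (suc (toℕ j)))
    ≡⟨ sum-cong-≗ {B} (λ j → merge (toℕ j)) ⟩
  ∑[ j < B ] ((x C suc (toℕ j)) * S (suc n) (suc (toℕ j)))
    ∎
  where
  S = surjections
  g h : ℕ → ℕ
  g j = suc j * (x C suc j) * S n j
  h j = j * (x C j) * S n j
  ∑g = ∑[ j < B ] g (toℕ j)
  ∑h = ∑[ j < B ] h (suc (toℕ j))
  split : ∀ j → x * ((x C j) * S n j) ≡ g j + h j
  split j = begin
    x * ((x C j) * S n j)                       ≡⟨ *-assoc x (x C j) (S n j) ⟨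
    x * (x C j) * S n j                         ≡⟨ cong (_* S n j) (n*nCk≡[1+k]*nC[1+k]+k*nCk x j) ⟩
    (suc j * (x C suc j) + j * (x C j)) * S n j ≡⟨ *-distribʳ-+ (S n j) (suc j * (x C suc j)) (j * (x C j)) ⟩
    g j + h j                                   ∎
  merge : ∀ j → g j + h (suc j) ≡ (x C suc j) * S (suc n) (suc j)
  merge j = begin
    g j + h (suc j)                               ≡⟨ solve 4 (λ k c s t → k :* c :* s :+ k :* c :* t := c :* (k :* (s :+ t)))
                                                       refl (suc j) (x C suc j) (S n j) (S n (suc j)) ⟩
    (x C suc j) * (suc j * (S n j + S n (suc j))) ≡⟨ cong ((x C suc j) *_) (surjections-suc n j) ⟨
    (x C suc j) * S (suc n) (suc j)               ∎
  g[B]≡0 : g B ≡ 0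
  g[B]≡0 = trans (cong (λ c → suc B * c * S n B) (k>n⇒nCk≡0 x<B)) (cong (_* S n B) (*-zeroʳ (suc B)))

surjections-%-cong : ∀ {d n m} .{{_ : NonZero d}} → (∀ x → x ^ n % d ≡ x ^ m % d) →
                     ∀ j → surjections n j % d ≡ surjections m j % d
surjections-%-cong {d} {n} {m} x^n≡x^m = <-rec P step
  where
  P : ℕ → Set
  P j = surjections n j % d ≡ surjections m j % d
  step : ∀ j → (∀ {i} → i < j → P i) → P j
  step j IH =
    +-cancel-% lower≡ (subst₂ (λ u v → u % d ≡ v % d) (expand n) (expand m) (x^n≡x^m j))
    where
    lower : ℕ → ℕ
    lower k = ∑[ i < j ] ((j C toℕ i) * surjections k (toℕ i))
    expand : ∀ k → j ^ k ≡ lower k + surjections k j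
    expand k = begin
      j ^ k                                                 ≡⟨ ^≡∑C*surjections (n<1+n j) k ⟩
      ∑[ i < suc j ] ((j C toℕ i) * surjections k (toℕ i))  ≡⟨ ∑-init-last j (λ i → (j C i) * surjections k i) ⟩
      lower k + (j C j) * surjections k j                   ≡⟨ cong (λ c → lower k + c * surjections k j) (nCn≡1 j) ⟩
      lower k + 1 * surjections k j                         ≡⟨ cong (lower k +_) (*-identityˡ (surjections k j)) ⟩
      lower k + surjections k j                             ∎
    lower≡ : lower n % d ≡ lower m % d
    lower≡ = %-cong-sum {n = j}
      (λ i → (j C toℕ i) * surjections n (toℕ i)) (λ i → (j C toℕ i) * surjections m (toℕ i))
      (λ i → %-cong-* {a = j C toℕ i} refl (IH (toℕ<n i)))

lemma3p6 : (p n m N : ℕ) → Prime p → n > 0 → m > 0 → N > 0 →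
           n ≡ m [mod φ (p ^ N) ] → n ≥ N → m ≥ N →
           (j : ℕ) → (j !) * S₂ n j ≡ (j !) * S₂ m j [mod p ^ N ]
lemma3p6 p n m N pr _ _ N>0 n≡m N≤n N≤m j =
  %≡%⇒≡[mod] (surjections-%-cong {n = n} {m} (^-%-cong-prime^ pr N>0 {n} {m} n≡m N≤n N≤m) j)
  where
  instance
    p≢0   = prime⇒nonZero pr
    p^N≢0 = m^n≢0 p N
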